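{- Let $p$ be a prime and let $d$ be a positive divisor of $p-1$. The integers $x$ with $1 \leq x \leq p-1$, $\operatorname{ord}_p x = d$ and $x^x \equiv x \pmod p$ are exactly the elements of the set $\{1, d+1, 2d+1, \ldots, p-d\}$ which have multiplicative order $d$ modulo $p$.
   Context: $\operatorname{ord}_p x$ denotes the multiplicative order of $x$ modulo $p$. -}

module Defs where

open import Data.Nat using (ℕ; zero; suc; _+_; _*_; _∸_; _^_; _≤_; _<_; NonZero)
open import Data.Nat.DivMod using (_%_)
open import Data.Product using (_×_; ∃-syntax)
open import Relation.Binary.PropositionalEquality using (_≡_; _≢_)

_≡_[mod_] : ℕ → ℕ → (m : ℕ) → .{{NonZero m}} → Set
a ≡ b [mod m ] = a % m ≡ b % m

IsOrder : (m : ℕ) → .{{NonZero m}} → ℕ → ℕ → Set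
IsOrder m x d =
  (1 ≤ d) × ((x ^ d) ≡ 1 [mod m ]) × (∀ k → 1 ≤ k → k < d → ((x ^ k) % m ≢ 1 % m))

module Submission where

-- Suppose x has order d modulo m.  Since x^d ≡ 1, x is
-- invertible modulo m, so x^x ≡ x is equivalent to x^(x-1) ≡ 1, i.e. (as d is
-- the order) to d ∣ x - 1: the solutions are exactly the x ≡ 1 (mod d) in the
-- arithmetic progression 1, d+1, 2d+1, ...  When moreover d ∣ p - 1, the
-- largest term of this progression that is at most p - 1 is p - d, so the two
-- range conditions 1 ≤ x ≤ p - 1 and x ≤ p - d agree on the progression.
--
-- Together with an elementary bound on multiples of d
-- this yields mainTheorem3.

open import Defs
open import Data.Nat using (ℕ; zero; suc; _+_; _*_; _∸_; _^_; _≤_; NonZero; >-nonZero; s≤s; z≤n)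
open import Data.Nat.Properties
open import Data.Nat.DivMod using (_%_; _/_; %-distribˡ-*; m≡m%n+[m/n]*n; m%n<n)
open import Data.Nat.Divisibility using (_∣_; divides; m%n≡0⇒n∣m)
open import Data.Nat.Primality using (Prime)
open import Data.Product using (_×_; ∃-syntax; _,_)
open import Function.Bundles using (_⇔_; mk⇔)
open import Relation.Binary.PropositionalEquality
open import Relation.Nullary using (contradiction)

open _∣_ using (quotient; equality)

module Congruence (m : ℕ) .{{_ : NonZero m}} where

  *-congˡ-mod : ∀ c {a b} → a ≡ b [mod m ] → (c * a) ≡ (c * b) [mod m ]
  *-congˡ-mod c {a} {b} a≡b = begin
    (c * a) % m                 ≡⟨ %-distribˡ-* c a m ⟩
    ((c % m) * (a % m)) % m     ≡⟨ cong (λ t → ((c % m) * t) % m) a≡b ⟩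
    ((c % m) * (b % m)) % m     ≡⟨ %-distribˡ-* c b m ⟨
    (c * b) % m                 ∎
    where open ≡-Reasoning

  *-congʳ-mod : ∀ c {a b} → a ≡ b [mod m ] → (a * c) ≡ (b * c) [mod m ]
  *-congʳ-mod c {a} {b} a≡b =
    trans (cong (_% m) (*-comm a c)) (trans (*-congˡ-mod c a≡b) (cong (_% m) (*-comm c b)))

  *-unitʳ-mod : ∀ c {a} → a ≡ 1 [mod m ] → (c * a) ≡ c [mod m ]
  *-unitʳ-mod c a≡1 = trans (*-congˡ-mod c a≡1) (cong (_% m) (*-identityʳ c))

  ^-one-mod : ∀ {a} q → a ≡ 1 [mod m ] → (a ^ q) ≡ 1 [mod m ]
  ^-one-mod zero    a≡1 = refl
  ^-one-mod {a} (suc q) a≡1 =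
    trans (*-congʳ-mod (a ^ q) a≡1) (trans (cong (_% m) (*-identityˡ (a ^ q))) (^-one-mod q a≡1))

module Periodic (m : ℕ) .{{_ : NonZero m}} {x d : ℕ} (xᵈ≡1 : (x ^ d) ≡ 1 [mod m ]) where

  open Congruence m

  ^-shift-period : ∀ n k → (x ^ (n + k * d)) ≡ (x ^ n) [mod m ]
  ^-shift-period n k = begin
    (x ^ (n + k * d)) % m       ≡⟨ cong (_% m) (^-distribˡ-+-* x n (k * d)) ⟩
    (x ^ n * x ^ (k * d)) % m   ≡⟨ cong (λ t → (x ^ n * x ^ t) % m) (*-comm k d) ⟩
    (x ^ n * x ^ (d * k)) % m   ≡⟨ cong (λ t → (x ^ n * t) % m) (^-*-assoc x d k) ⟨
    (x ^ n * (x ^ d) ^ k) % m   ≡⟨ *-unitʳ-mod (x ^ n) (^-one-mod k xᵈ≡1) ⟩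
    (x ^ n) % m                 ∎
    where open ≡-Reasoning

  -- If x^d ≡ 1 with d ≥ 1 then x is invertible (with inverse x^(d-1)), so x
  -- can be cancelled from x^(n+1) ≡ x.
  cancel-fixed-point : 1 ≤ d → ∀ n → (x ^ suc n) ≡ x [mod m ] → (x ^ n) ≡ 1 [mod m ]
  cancel-fixed-point (s≤s {n = e} z≤n) n xⁿ⁺¹≡x = begin
    (x ^ n) % m                 ≡⟨ *-unitʳ-mod (x ^ n) xᵈ≡1 ⟨
    (x ^ n * (x * x ^ e)) % m   ≡⟨ cong (_% m) (*-assoc (x ^ n) x (x ^ e)) ⟨
    (x ^ n * x * x ^ e) % m     ≡⟨ cong (λ t → (t * x ^ e) % m) (*-comm (x ^ n) x) ⟩
    (x ^ suc n * x ^ e) % m     ≡⟨ *-congʳ-mod (x ^ e) xⁿ⁺¹≡x ⟩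
    (x ^ suc e) % m             ≡⟨ xᵈ≡1 ⟩
    1 % m                       ∎
    where open ≡-Reasoning

-- The order d of x divides every exponent n with x^n ≡ 1: writing n = r + qd
-- with r < d gives x^r ≡ x^n ≡ 1, and minimality of d forces r = 0.
order-divides : ∀ m .{{_ : NonZero m}} {x d n} → IsOrder m x d → (x ^ n) ≡ 1 [mod m ] → d ∣ n
order-divides m {x} {d} {n} (1≤d , xᵈ≡1 , minimal) xⁿ≡1 = m%n≡0⇒n∣m n d remainder≡0
  where
  instance _ = >-nonZero 1≤d
  open Periodic m {x} {d} xᵈ≡1

  xʳ≡1 : (x ^ (n % d)) ≡ 1 [mod m ]
  xʳ≡1 = begin
    (x ^ (n % d)) % m               ≡⟨ ^-shift-period (n % d) (n / d) ⟨
    (x ^ (n % d + n / d * d)) % m   ≡⟨ cong (λ t → (x ^ t) % m) (m≡m%n+[m/n]*n n d) ⟨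
    (x ^ n) % m                     ≡⟨ xⁿ≡1 ⟩
    1 % m                           ∎
    where open ≡-Reasoning

  remainder≡0 : n % d ≡ 0
  remainder≡0 with n % d | xʳ≡1 | m%n<n n d
  ... | zero  | _    | _   = refl
  ... | suc r | xʳ≡1 | r<d = contradiction xʳ≡1 (minimal (suc r) (s≤s z≤n) r<d)

-- For x of order d, every solution x ≥ 1 of x^x ≡ x is a term 1 + kd of the
-- arithmetic progression with difference d, since d ∣ x - 1.
fixed-point⇒progression : ∀ m .{{_ : NonZero m}} {x d} → IsOrder m x d → 1 ≤ x →
  (x ^ x) ≡ x [mod m ] → ∃[ k ] x ≡ 1 + k * d
fixed-point⇒progression m {d = d} order@(1≤d , xᵈ≡1 , _) (s≤s {n = y} z≤n) xˣ≡x =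
  quotient d∣y , cong suc (equality d∣y)
  where
  open Periodic m {suc y} {d} xᵈ≡1

  d∣y : d ∣ y
  d∣y = order-divides m order (cancel-fixed-point 1≤d y xˣ≡x)

progression⇒fixed-point : ∀ m .{{_ : NonZero m}} {x d} k → (x ^ d) ≡ 1 [mod m ] →
  x ≡ 1 + k * d → (x ^ x) ≡ x [mod m ]
progression⇒fixed-point m {x} {d} k xᵈ≡1 refl =
  trans (^-shift-period 1 k) (cong (_% m) (*-identityʳ x))
  where open Periodic m {x} {d} xᵈ≡1

-- If d ∣ n then a term 1 + kd of the progression that is at most n is in
-- fact at most n + 1 - d, because the next multiple of d still fits below n.
progression-bound : ∀ {n d k} → d ∣ n → 1 + k * d ≤ n → 1 + k * d ≤ suc n ∸ d
progression-bound {d = d} {k} (divides q refl) 1+kd≤qd =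
  m+n≤o⇒m≤o∸n (1 + k * d) (s≤s next-multiple≤qd)
  where
  next-multiple≤qd : k * d + d ≤ q * d
  next-multiple≤qd = subst (_≤ q * d) (+-comm d (k * d)) (*-monoˡ-≤ d (*-cancelʳ-< d k q 1+kd≤qd))

mainTheorem3 : (p : ℕ) → .{{_ : NonZero p}} → Prime p → (d : ℕ) → 1 ≤ d → d ∣ (p ∸ 1) → (x : ℕ) →
    ((1 ≤ x × x ≤ p ∸ 1) × IsOrder p x d × (x ^ x) ≡ x [mod p ])
      ⇔ ((∃[ k ] (x ≡ 1 + k * d × x ≤ p ∸ d)) × IsOrder p x d)
mainTheorem3 p@(suc n) _ d 1≤d d∣n x = mk⇔ forward backward
  where
  forward : ((1 ≤ x × x ≤ n) × IsOrder p x d × (x ^ x) ≡ x [mod p ])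
          → ((∃[ k ] (x ≡ 1 + k * d × x ≤ p ∸ d)) × IsOrder p x d)
  forward ((1≤x , x≤n) , order , xˣ≡x) with fixed-point⇒progression p order 1≤x xˣ≡x
  ... | k , x≡1+kd = (k , x≡1+kd , x≤p-d) , order
    where
    x≤p-d : x ≤ p ∸ d
    x≤p-d = subst (_≤ p ∸ d) (sym x≡1+kd) (progression-bound {k = k} d∣n (subst (_≤ n) x≡1+kd x≤n))

  backward : ((∃[ k ] (x ≡ 1 + k * d × x ≤ p ∸ d)) × IsOrder p x d)
           → ((1 ≤ x × x ≤ n) × IsOrder p x d × (x ^ x) ≡ x [mod p ])
  backward ((k , x≡1+kd , x≤p-d) , order@(_ , xᵈ≡1 , _)) =
    (1≤x , ≤-trans x≤p-d (∸-monoʳ-≤ p 1≤d)) , order , progression⇒fixed-point p k xᵈ≡1 x≡1+kd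
    where
    1≤x : 1 ≤ x
    1≤x = subst (1 ≤_) (sym x≡1+kd) (s≤s z≤n)
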